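{- Let $U$ be the uniform metric space on $u$ points (any two distinct points have distance $1$). Let $S=\{s_1,\dots,s_q\}$ be a set of $q$ distinct points of $U$ (servers) and $R=\{r_1,\dots,r_t\}$ a set of $t\le q$ distinct points of $U$ (requests), requested in the order $r_1,r_2,\dots,r_t$, fixed in advance. Let $\delta=|R\setminus S|$. Then the expected cost of the matching produced by RWGM is at most $H_q+H_{q-1}+\dots+H_{q-\delta+1}$, where $H_m=1+\frac12+\dots+\frac1m$ for $m\ge1$ and $H_m=0$ for $m\le 0$.
   Context: RWGM on the uniform metric space (the HST of height one whose leaves are the points of $U$): when request $r_j$ arrives, if there is an unused server located at $r_j$, match $r_j$ to it (cost $0$); otherwise match $r_j$ to a server chosen uniformly at random among the points that still carry an unused server (cost $1$). Each request is matched immediately and irrevocably; the cost is the sum of distances of matched pairs. -}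

module Defs where

open import Data.Nat using (ℕ; zero; suc; _∸_)
open import Data.Fin using (Fin; _≟_)
open import Data.List using (List; []; _∷_; filter; length; map; foldr)
open import Data.List.Relation.Unary.Any using (any?)
open import Data.Integer using (+_)
open import Data.Rational using (ℚ; 0ℚ; 1ℚ; _+_; _*_; _/_)
open import Relation.Nullary using (yes; no; ¬?)

-- Points of the uniform metric space U on u points: Fin u.
-- A set of points is a duplicate-free list; the "available" configuration
-- is the list of points still carrying an unused server (servers sit at
-- distinct points, so each point carries at most one server).

remove : ∀ {u} → Fin u → List (Fin u) → List (Fin u)
remove x A = filter (λ y → ¬? (x ≟ y)) A

sumℚ : List ℚ → ℚ
sumℚ = foldr _+_ 0ℚ

avg : List ℚ → ℚ
avg [] = 0ℚ
avg (x ∷ xs) = sumℚ (x ∷ xs) * ((+ 1) / suc (length xs))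

-- Exact expected cost of RWGM on the uniform metric, given the points A
-- that still carry an unused server and the remaining request sequence.
expCostRWGM : ∀ {u} → List (Fin u) → List (Fin u) → ℚ
expCostRWGM A [] = 0ℚ
expCostRWGM A (r ∷ rs) with any? (r ≟_) A
... | yes _ = expCostRWGM (remove r A) rs
... | no  _ = 1ℚ + avg (map (λ a → expCostRWGM (remove a A) rs) A)

H : ℕ → ℚ
H zero = 0ℚ
H (suc m) = H m + (+ 1) / suc m

harmonicTail : ℕ → ℕ → ℚ
harmonicTail q zero = 0ℚ
harmonicTail q (suc d) = H (q ∸ d) + harmonicTail q d

delta : ∀ {u} → List (Fin u) → List (Fin u) → ℕ
delta S R = length (filter (λ r → ¬? (any? (r ≟_) S)) R)

-- For free servers S, remaining requests R = x₀ x₁ … and a level k let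
--   potential S k R = Σᵢ [xᵢ ∉ S] · H (k ∸ i).
-- Invariant (induction on R, for Unique S, Unique R, |R| ≤ |S|):
--   expCostRWGM S R ≤ potential S |S| R.
-- Removing the server at a raises the potential by at most
-- bump a k R = Σᵢ [xᵢ = a] · H (k ∸ i), which is 0 if a is not requested
-- again; this settles a request that hits S.  For a miss we pay 1 plus the
-- average over the random a; distinct servers bump distinct requests, so the
-- average bump is at most (H_k + … + H_1)/(k+1), and the harmonic identity
-- 1 + (H_1 + … + H_k)/(k+1) = H_{k+1} restores the invariant.  Finally only
-- the δ requests outside S carry potential, giving H_q + … + H_{q-δ+1}.
module Submission where

open import Defs
open import Data.Nat using (ℕ) renaming (_≤_ to _≤ℕ_)
open import Data.Fin using (Fin)
open import Data.List using (List; length)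
open import Data.List.Relation.Unary.Unique.Propositional using (Unique)
open import Data.Rational using (_≤_)

open import Data.Nat using (zero; suc; pred; _∸_; z≤n; s≤s; _≤′_; ≤′-refl; ≤′-step)
import Data.Nat.Properties as ℕP
import Data.Nat.Coprimality as Coprime
open import Data.Fin using (_≟_)
open import Data.List using ([]; _∷_; map)
open import Data.List.Properties using (length-map; filter-all)
open import Data.List.Relation.Unary.Any using (here; there; any?)
open import Data.List.Relation.Unary.All using (All; []; _∷_)
open import Data.List.Relation.Unary.AllPairs using ([]; _∷_)
open import Data.List.Membership.Propositional using (_∈_)
open import Data.List.Membership.Propositional.Properties using (∈-filter⁺)
import Data.List.Relation.Unary.Unique.Propositional.Properties as Unique
import Data.Integer as ℤ
import Data.Integer.Properties as ℤP
open import Data.Rational using (ℚ; 0ℚ; 1ℚ; _+_; _*_; _/_; mkℚ)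
open import Data.Rational.Properties hiding (_≟_)
open import Algebra.Bundles using (Ring; CommutativeMonoid)
open import Algebra.Properties.Semiring.Mult (Ring.semiring +-*-ring)
  using (_×_; ×-comm-*; ×-assoc-*)
open import Algebra.Properties.CommutativeMonoid.Mult +-0-commutativeMonoid
  using (×-distrib-+)
open import Algebra.Properties.CommutativeSemigroup
  (CommutativeMonoid.commutativeSemigroup +-0-commutativeMonoid)
  using () renaming (interchange to +-interchange)
open import Data.Empty using (⊥-elim)
open import Relation.Nullary using (yes; no; ¬_; ¬?)
open import Relation.Binary.PropositionalEquality

1/suc : ℕ → ℚ
1/suc k = ℤ.+ 1 / suc k

nat : ℕ → ℚ
nat n = mkℚ (ℤ.+ n) 0 (Coprime.sym (Coprime.1-coprimeTo n))

inv : ℕ → ℚ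
inv k = mkℚ (ℤ.+ 1) k (Coprime.1-coprimeTo (suc k))

×-one : ∀ n → n × 1ℚ ≡ nat n
×-one zero = refl
×-one (suc n) = begin
  1ℚ + n × 1ℚ
    ≡⟨ cong (1ℚ +_) (×-one n) ⟩
  1ℚ + nat n
    ≡⟨ /-cong (cong (λ z → ℤ.+ 1 ℤ.+ z) (ℤP.*-identityʳ (ℤ.+ n))) refl ⟩
  ℤ.+ suc n / 1
    ≡⟨ normalize-coprime (Coprime.sym (Coprime.1-coprimeTo (suc n))) ⟩
  nat (suc n) ∎
  where open ≡-Reasoning

×-inverse : ∀ k → suc k × (1/suc k) ≡ 1ℚ
×-inverse k = begin
  suc k × w                     ≡⟨ cong (suc k ×_) (sym (*-identityʳ w)) ⟩
  suc k × (w * 1ℚ)              ≡⟨ sym (×-comm-* (suc k) w 1ℚ) ⟩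
  w * (suc k × 1ℚ)              ≡⟨ cong₂ _*_ (normalize-coprime (Coprime.1-coprimeTo (suc k))) (×-one (suc k)) ⟩
  inv k * nat (suc k)           ≡⟨ *-inverseˡ (nat (suc k)) ⟩
  1ℚ ∎
  where
  open ≡-Reasoning
  w = 1/suc k

×-cancel : ∀ k x → (suc k × x) * (1/suc k) ≡ x
×-cancel k x = begin
  (suc k × x) * w  ≡⟨ ×-assoc-* (suc k) x w ⟩
  suc k × (x * w)  ≡⟨ cong (suc k ×_) (*-comm x w) ⟩
  suc k × (w * x)  ≡⟨ sym (×-assoc-* (suc k) w x) ⟩
  (suc k × w) * x  ≡⟨ cong (_* x) (×-inverse k) ⟩
  1ℚ * x           ≡⟨ *-identityˡ x ⟩
  x ∎
  where
  open ≡-Reasoning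
  w = 1/suc k

1/suc≥0 : ∀ k → 0ℚ ≤ 1/suc k
1/suc≥0 k = nonNegative⁻¹ (1/suc k) {{normalize-nonNeg 1 (suc k)}}

≤-+-nonNegʳ : ∀ a {b} → 0ℚ ≤ b → a ≤ a + b
≤-+-nonNegʳ a 0≤b = ≤-trans (≤-reflexive (sym (+-identityʳ a))) (+-monoʳ-≤ a 0≤b)

≤-+-nonNegˡ : ∀ {a} b → 0ℚ ≤ a → b ≤ a + b
≤-+-nonNegˡ b 0≤a = ≤-trans (≤-reflexive (sym (+-identityˡ b))) (+-monoˡ-≤ b 0≤a)

H≥0 : ∀ k → 0ℚ ≤ H k
H≥0 zero = ≤-refl
H≥0 (suc k) = ≤-trans (H≥0 k) (≤-+-nonNegʳ (H k) (1/suc≥0 k))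

H-mono : ∀ {j k} → j ≤ℕ k → H j ≤ H k
H-mono j≤k = go (ℕP.≤⇒≤′ j≤k)
  where
  go : ∀ {j k} → j ≤′ k → H j ≤ H k
  go ≤′-refl = ≤-refl
  go {k = suc k} (≤′-step j≤′k) = ≤-trans (go j≤′k) (≤-+-nonNegʳ (H k) (1/suc≥0 k))

-- Descending sums  harmonicDesc k n = H k + H (k ∸ 1) + … + H (k ∸ (n ∸ 1)):
-- the same quantity as harmonicTail k n, but peeling off the largest term,
-- which is the order in which requests are served.
harmonicDesc : ℕ → ℕ → ℚ
harmonicDesc k zero = 0ℚ
harmonicDesc k (suc n) = H k + harmonicDesc (pred k) n

harmonicDesc≥0 : ∀ k n → 0ℚ ≤ harmonicDesc k n
harmonicDesc≥0 k zero = ≤-refl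
harmonicDesc≥0 k (suc n) = ≤-trans (harmonicDesc≥0 (pred k) n) (≤-+-nonNegˡ _ (H≥0 k))

harmonicDesc-monoˡ : ∀ {j k} n → j ≤ℕ k → harmonicDesc j n ≤ harmonicDesc k n
harmonicDesc-monoˡ zero j≤k = ≤-refl
harmonicDesc-monoˡ (suc n) j≤k =
  +-mono-≤ (H-mono j≤k) (harmonicDesc-monoˡ n (ℕP.pred-mono-≤ j≤k))

harmonicDesc-monoʳ : ∀ k {m n} → m ≤ℕ n → harmonicDesc k m ≤ harmonicDesc k n
harmonicDesc-monoʳ k {n = n} z≤n = harmonicDesc≥0 k n
harmonicDesc-monoʳ k (s≤s m≤n) = +-monoʳ-≤ (H k) (harmonicDesc-monoʳ (pred k) m≤n)

harmonicDesc-snoc : ∀ k n → harmonicDesc k (suc n) ≡ H (k ∸ n) + harmonicDesc k n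
harmonicDesc-snoc k zero = refl
harmonicDesc-snoc k (suc n) = begin
  H k + harmonicDesc (pred k) (suc n)
    ≡⟨ cong (H k +_) (harmonicDesc-snoc (pred k) n) ⟩
  H k + (H (pred k ∸ n) + harmonicDesc (pred k) n)
    ≡⟨ sym (+-assoc (H k) _ _) ⟩
  (H k + H (pred k ∸ n)) + harmonicDesc (pred k) n
    ≡⟨ cong (_+ harmonicDesc (pred k) n) (+-comm (H k) _) ⟩
  (H (pred k ∸ n) + H k) + harmonicDesc (pred k) n
    ≡⟨ +-assoc (H (pred k ∸ n)) (H k) (harmonicDesc (pred k) n) ⟩
  H (pred k ∸ n) + (H k + harmonicDesc (pred k) n)
    ≡⟨ cong (λ i → H i + harmonicDesc k (suc n)) (pred-∸ k n) ⟩
  H (k ∸ suc n) + harmonicDesc k (suc n) ∎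
  where
  open ≡-Reasoning
  pred-∸ : ∀ k n → pred k ∸ n ≡ k ∸ suc n
  pred-∸ zero n = ℕP.0∸n≡0 n
  pred-∸ (suc k) n = refl

harmonicDesc≡harmonicTail : ∀ k n → harmonicDesc k n ≡ harmonicTail k n
harmonicDesc≡harmonicTail k zero = refl
harmonicDesc≡harmonicTail k (suc n) =
  trans (harmonicDesc-snoc k n) (cong (H (k ∸ n) +_) (harmonicDesc≡harmonicTail k n))

harmonic-sum : ∀ k → harmonicDesc k k + suc k × 1ℚ ≡ suc k × H (suc k)
harmonic-sum zero = refl
harmonic-sum (suc k) = begin
  (h + harmonicDesc k k) + (1ℚ + suc k × 1ℚ)
    ≡⟨ +-interchange h _ 1ℚ _ ⟩
  (h + 1ℚ) + (harmonicDesc k k + suc k × 1ℚ)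
    ≡⟨ cong ((h + 1ℚ) +_) (harmonic-sum k) ⟩
  (h + 1ℚ) + suc k × h
    ≡⟨ +-assoc h 1ℚ _ ⟩
  h + (1ℚ + suc k × h)
    ≡⟨ cong (h +_) (+-comm 1ℚ (suc k × h)) ⟩
  h + (suc k × h + 1ℚ)
    ≡⟨ sym (+-assoc h _ 1ℚ) ⟩
  suc (suc k) × h + 1ℚ
    ≡⟨ cong (suc (suc k) × h +_) (sym (×-inverse (suc k))) ⟩
  suc (suc k) × h + suc (suc k) × (1/suc (suc k))
    ≡⟨ sym (×-distrib-+ h _ (suc (suc k))) ⟩
  suc (suc k) × H (suc (suc k)) ∎
  where
  open ≡-Reasoning
  h = H (suc k)

harmonic-average : ∀ k → 1ℚ + harmonicDesc k k * (1/suc k) ≡ H (suc k)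
harmonic-average k = begin
  1ℚ + t * w                  ≡⟨ cong (_+ t * w) (sym (×-cancel k 1ℚ)) ⟩
  (suc k × 1ℚ) * w + t * w    ≡⟨ +-comm _ (t * w) ⟩
  t * w + (suc k × 1ℚ) * w    ≡⟨ sym (*-distribʳ-+ w t _) ⟩
  (t + suc k × 1ℚ) * w        ≡⟨ cong (_* w) (harmonic-sum k) ⟩
  (suc k × H (suc k)) * w     ≡⟨ ×-cancel k (H (suc k)) ⟩
  H (suc k) ∎
  where
  open ≡-Reasoning
  t = harmonicDesc k k
  w = 1/suc k

module _ {A : Set} where

  sum-mono : (f g : A → ℚ) (xs : List A) → (∀ x → x ∈ xs → f x ≤ g x) →
             sumℚ (map f xs) ≤ sumℚ (map g xs)
  sum-mono f g [] f≤g = ≤-refl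
  sum-mono f g (x ∷ xs) f≤g =
    +-mono-≤ (f≤g x (here refl)) (sum-mono f g xs (λ y y∈xs → f≤g y (there y∈xs)))

  sum-+ : (f g : A → ℚ) (xs : List A) →
          sumℚ (map (λ x → f x + g x) xs) ≡ sumℚ (map f xs) + sumℚ (map g xs)
  sum-+ f g [] = sym (+-identityʳ 0ℚ)
  sum-+ f g (x ∷ xs) = trans (cong (f x + g x +_) (sum-+ f g xs)) (+-interchange (f x) _ _ _)

  sum-const : (c : ℚ) (xs : List A) → sumℚ (map (λ _ → c) xs) ≡ length xs × c
  sum-const c [] = refl
  sum-const c (x ∷ xs) = cong (c +_) (sum-const c xs)

  avg-bound : (f g : A → ℚ) (c : ℚ) (x : A) (xs : List A) →
              (∀ y → y ∈ x ∷ xs → f y ≤ c + g y) →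
              avg (map f (x ∷ xs)) ≤ c + sumℚ (map g (x ∷ xs)) * 1/suc (length xs)
  avg-bound f g c x xs f≤ = begin
    avg (map f (x ∷ xs))
      ≡⟨ cong (λ n → sumℚ (map f (x ∷ xs)) * (1/suc n)) (length-map f xs) ⟩
    sumℚ (map f (x ∷ xs)) * w
      ≤⟨ *-monoʳ-≤-nonNeg w {{normalize-nonNeg 1 (suc n)}} (sum-mono f (λ y → c + g y) (x ∷ xs) f≤) ⟩
    sumℚ (map (λ y → c + g y) (x ∷ xs)) * w
      ≡⟨ cong (_* w) (sum-+ (λ _ → c) g (x ∷ xs)) ⟩
    (sumℚ (map (λ _ → c) (x ∷ xs)) + sumℚ (map g (x ∷ xs))) * w
      ≡⟨ cong (λ s → (s + sumℚ (map g (x ∷ xs))) * w) (sum-const c (x ∷ xs)) ⟩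
    (suc n × c + sumℚ (map g (x ∷ xs))) * w
      ≡⟨ *-distribʳ-+ w (suc n × c) _ ⟩
    (suc n × c) * w + sumℚ (map g (x ∷ xs)) * w
      ≡⟨ cong (_+ sumℚ (map g (x ∷ xs)) * w) (×-cancel n c) ⟩
    c + sumℚ (map g (x ∷ xs)) * w ∎
    where
    open ≤-Reasoning
    n = length xs
    w = 1/suc n

module _ {u : ℕ} where

  length-remove : ∀ {a : Fin u} {S : List (Fin u)} → a ∈ S → Unique S →
                  suc (length (remove a S)) ≡ length S
  length-remove {a} {y ∷ ys} a∈S (y∉ys ∷ uys) with a ≟ y
  ... | yes refl = cong suc (cong length (filter-all (λ z → ¬? (a ≟ z)) y∉ys))
  ... | no a≢y with a∈S
  ...   | here a≡y = ⊥-elim (a≢y a≡y)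
  ...   | there a∈ys = cong suc (length-remove a∈ys uys)

  unique-remove : ∀ (a : Fin u) {S : List (Fin u)} → Unique S → Unique (remove a S)
  unique-remove a uS = Unique.filter⁺ (λ z → ¬? (a ≟ z)) uS

  missCost : List (Fin u) → Fin u → ℕ → ℚ
  missCost S x k with any? (x ≟_) S
  ... | yes _ = 0ℚ
  ... | no _ = H k

  potential : List (Fin u) → ℕ → List (Fin u) → ℚ
  potential S k [] = 0ℚ
  potential S k (x ∷ xs) = missCost S x k + potential S (pred k) xs

  potential≤harmonicDesc : ∀ S k R → potential S k R ≤ harmonicDesc k (delta S R)
  potential≤harmonicDesc S k [] = ≤-refl
  potential≤harmonicDesc S k (x ∷ xs) with any? (x ≟_) S
  ... | yes _ = begin
    0ℚ + potential S (pred k) xs            ≡⟨ +-identityˡ _ ⟩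
    potential S (pred k) xs                 ≤⟨ potential≤harmonicDesc S (pred k) xs ⟩
    harmonicDesc (pred k) (delta S xs)      ≤⟨ harmonicDesc-monoˡ (delta S xs) ℕP.pred[n]≤n ⟩
    harmonicDesc k (delta S xs) ∎
    where open ≤-Reasoning
  ... | no _ = +-monoʳ-≤ (H k) (potential≤harmonicDesc S (pred k) xs)

  hit : Fin u → Fin u → ℕ → ℚ
  hit a x k with a ≟ x
  ... | yes _ = H k
  ... | no _ = 0ℚ

  bump : Fin u → ℕ → List (Fin u) → ℚ
  bump a k [] = 0ℚ
  bump a k (x ∷ xs) = hit a x k + bump a (pred k) xs

  missCost≤H : ∀ S x k → missCost S x k ≤ H k
  missCost≤H S x k with any? (x ≟_) S
  ... | yes _ = H≥0 k
  ... | no _ = ≤-refl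

  missCost-remove-other : ∀ S {a x} k → ¬ a ≡ x → missCost (remove a S) x k ≤ missCost S x k
  missCost-remove-other S {a} {x} k a≢x with any? (x ≟_) S
  ... | no _ = missCost≤H (remove a S) x k
  ... | yes x∈S with any? (x ≟_) (remove a S)
  ...   | yes _ = ≤-refl
  ...   | no x∉S-a = ⊥-elim (x∉S-a (∈-filter⁺ (λ y → ¬? (a ≟ y)) x∈S a≢x))

  missCost-remove : ∀ S a x k → missCost (remove a S) x k ≤ missCost S x k + hit a x k
  missCost-remove S a x k with a ≟ x
  ... | yes _ = ≤-trans (missCost≤H (remove a S) x k) (≤-+-nonNegˡ (H k) (missCost-≥0 S x k))
    where
    missCost-≥0 : ∀ S x k → 0ℚ ≤ missCost S x k
    missCost-≥0 S x k with any? (x ≟_) S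
    ... | yes _ = ≤-refl
    ... | no _ = H≥0 k
  ... | no a≢x = ≤-trans (missCost-remove-other S k a≢x) (≤-reflexive (sym (+-identityʳ _)))

  potential-remove : ∀ S a k R → potential (remove a S) k R ≤ potential S k R + bump a k R
  potential-remove S a k [] = ≤-reflexive (sym (+-identityʳ 0ℚ))
  potential-remove S a k (x ∷ xs) = ≤-trans
    (+-mono-≤ (missCost-remove S a x k) (potential-remove S a (pred k) xs))
    (≤-reflexive (+-interchange (missCost S x k) (hit a x k) _ _))

  bump-unrequested : ∀ a k R → All (λ y → ¬ a ≡ y) R → bump a k R ≡ 0ℚ
  bump-unrequested a k [] _ = refl
  bump-unrequested a k (x ∷ xs) (a≢x ∷ a∉xs) with a ≟ x
  ... | yes a≡x = ⊥-elim (a≢x a≡x)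
  ... | no _ = trans (+-identityˡ _) (bump-unrequested a (pred k) xs a∉xs)

  sum-hit : ∀ (S : List (Fin u)) x k → Unique S → sumℚ (map (λ a → hit a x k) S) ≤ H k
  sum-hit [] x k _ = H≥0 k
  sum-hit (y ∷ ys) x k (y∉ys ∷ uys) with y ≟ x
  ... | yes refl = ≤-reflexive (trans (cong (H k +_) (no-other-hits ys y∉ys)) (+-identityʳ (H k)))
    where
    no-other-hits : ∀ zs → All (λ z → ¬ y ≡ z) zs → sumℚ (map (λ a → hit a y k) zs) ≡ 0ℚ
    no-other-hits [] _ = refl
    no-other-hits (z ∷ zs) (y≢z ∷ y∉zs) with z ≟ y
    ... | yes z≡y = ⊥-elim (y≢z (sym z≡y))
    ... | no _ = trans (+-identityˡ _) (no-other-hits zs y∉zs)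
  ... | no _ = ≤-trans (≤-reflexive (+-identityˡ _)) (sum-hit ys x k uys)

  sum-bump : ∀ (S : List (Fin u)) k R → Unique S → sumℚ (map (λ a → bump a k R) S) ≤ harmonicDesc k (length R)
  sum-bump S k [] uS = ≤-reflexive (trans (sum-const 0ℚ S) (zeros (length S)))
    where
    zeros : ∀ n → n × 0ℚ ≡ 0ℚ
    zeros zero = refl
    zeros (suc n) = trans (+-identityˡ _) (zeros n)
  sum-bump S k (x ∷ xs) uS = ≤-trans
    (≤-reflexive (sum-+ (λ a → hit a x k) (λ a → bump a (pred k) xs) S))
    (+-mono-≤ (sum-hit S x k uS) (sum-bump S (pred k) xs uS))

  Bounded : List (Fin u) → Set
  Bounded R = ∀ S → Unique S → length R ≤ℕ length S →
              expCostRWGM S R ≤ potential S (length S) R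

  bounded-remove : ∀ {R} → Bounded R → ∀ {S a k} → Unique S → a ∈ S → length S ≡ suc k →
                   length R ≤ℕ k → expCostRWGM (remove a S) R ≤ potential (remove a S) k R
  bounded-remove {R} IH {S} {a} {k} uS a∈S |S|≡1+k |R|≤k =
    subst (λ n → expCostRWGM (remove a S) R ≤ potential (remove a S) n R) |S-a|≡k
      (IH (remove a S) (unique-remove a uS) (subst (length R ≤ℕ_) (sym |S-a|≡k) |R|≤k))
    where
    |S-a|≡k : length (remove a S) ≡ k
    |S-a|≡k = ℕP.suc-injective (trans (length-remove a∈S uS) |S|≡1+k)

  bounded-step : ∀ r rs → All (λ y → ¬ r ≡ y) rs → Bounded rs → Bounded (r ∷ rs)
  bounded-step r rs r∉rs IH [] _ ()
  bounded-step r rs r∉rs IH S@(s ∷ S') uS (s≤s |rs|≤k) with any? (r ≟_) S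
  ... | yes r∈S = begin
    expCostRWGM (remove r S) rs           ≤⟨ bounded-remove {rs} IH uS r∈S refl |rs|≤k ⟩
    potential (remove r S) k rs           ≤⟨ potential-remove S r k rs ⟩
    potential S k rs + bump r k rs        ≡⟨ cong (potential S k rs +_) (bump-unrequested r k rs r∉rs) ⟩
    potential S k rs + 0ℚ                 ≡⟨ +-identityʳ _ ⟩
    potential S k rs                      ≡⟨ sym (+-identityˡ _) ⟩
    0ℚ + potential S k rs ∎
    where
    open ≤-Reasoning
    k = length S'
  ... | no _ = begin
    1ℚ + avg (map (λ a → expCostRWGM (remove a S) rs) S)
      ≤⟨ +-monoʳ-≤ 1ℚ (avg-bound _ (λ a → bump a k rs) c s S' after-removal) ⟩
    1ℚ + (c + sumℚ (map (λ a → bump a k rs) S) * w)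
      ≤⟨ +-monoʳ-≤ 1ℚ (+-monoʳ-≤ c (*-monoʳ-≤-nonNeg w {{normalize-nonNeg 1 (suc k)}} bumps≤)) ⟩
    1ℚ + (c + harmonicDesc k k * w)
      ≡⟨ cong (1ℚ +_) (+-comm c _) ⟩
    1ℚ + (harmonicDesc k k * w + c)
      ≡⟨ sym (+-assoc 1ℚ (harmonicDesc k k * w) c) ⟩
    (1ℚ + harmonicDesc k k * w) + c
      ≡⟨ cong (_+ c) (harmonic-average k) ⟩
    H (suc k) + c ∎
    where
    open ≤-Reasoning
    k = length S'
    c = potential S k rs
    w = 1/suc k
    after-removal : ∀ a → a ∈ S → expCostRWGM (remove a S) rs ≤ c + bump a k rs
    after-removal a a∈S = ≤-trans (bounded-remove {rs} IH uS a∈S refl |rs|≤k) (potential-remove S a k rs)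
    bumps≤ : sumℚ (map (λ a → bump a k rs) S) ≤ harmonicDesc k k
    bumps≤ = ≤-trans (sum-bump S k rs uS) (harmonicDesc-monoʳ k |rs|≤k)

  bounded : ∀ R → Unique R → Bounded R
  bounded [] _ S _ _ = ≤-refl
  bounded (r ∷ rs) (r∉rs ∷ urs) = bounded-step r rs r∉rs (bounded rs urs)

lemma3 : (u : ℕ) (S R : List (Fin u)) → Unique S → Unique R →
    length R ≤ℕ length S →
    expCostRWGM S R ≤ harmonicTail (length S) (delta S R)
lemma3 u S R uS uR |R|≤|S| = begin
  expCostRWGM S R                          ≤⟨ bounded R uR S uS |R|≤|S| ⟩
  potential S (length S) R                 ≤⟨ potential≤harmonicDesc S (length S) R ⟩
  harmonicDesc (length S) (delta S R)      ≡⟨ harmonicDesc≡harmonicTail (length S) (delta S R) ⟩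
  harmonicTail (length S) (delta S R) ∎
  where open ≤-Reasoning
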